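{- Let $c\ge 1$ and $k\ge 2$ be fixed integers. For every $c$-closed graph $G$ on $n$ vertices that contains no clique on $k$ vertices: (1) the number of edges of $G$ is $O(n^{3/2})$; (2) for every fixed integer $j>2$, $n_{j+1}(G)=O\!\left(n_j(G)^{1/2}\, n\right)$, where the implied constants may depend on $c$, $k$ and $j$ but not on $n$ or $G$.
   Context: All graphs are finite, simple and undirected. For a positive integer $c$, a graph is $c$-closed if every two distinct vertices with at least $c$ common neighbors are adjacent. For a positive integer $j$, $n_j(G)$ denotes the number of (not necessarily maximal) cliques on exactly $j$ vertices in $G$. -}

module Defs where

open import Data.Bool using (Bool; true; false; _∧_; _∨_; not; if_then_else_)
open import Data.Nat using (ℕ; zero; suc; _+_; _≤_; _<_)
open import Data.Nat.Properties using (_<?_)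
open import Data.Fin using (Fin; toℕ)
open import Data.Fin.Properties using (_≟_)
open import Data.Fin.Subset using (Subset; inside; outside; ∣_∣)
open import Data.List using (List; []; _∷_; _++_; map; concatMap; allFin)
open import Data.Bool.ListAction using (and)
open import Data.Vec using (Vec; []; _∷_; lookup)
open import Relation.Nullary.Decidable using (⌊_⌋)
open import Relation.Binary.PropositionalEquality using (_≡_; _≢_)

record Graph (n : ℕ) : Set where
  field
    adj    : Fin n → Fin n → Bool
    symm   : ∀ x y → adj x y ≡ adj y x
    irrefl : ∀ x → adj x x ≡ false
open Graph public

countTrue : List Bool → ℕ
countTrue []            = 0
countTrue (true  ∷ bs)  = suc (countTrue bs)
countTrue (false ∷ bs)  = countTrue bs

commonNbrs : ∀ {n} → Graph n → Fin n → Fin n → ℕ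
commonNbrs {n} G x y = countTrue (map (λ z → adj G x z ∧ adj G z y) (allFin n))

CClosed : ℕ → ∀ {n} → Graph n → Set
CClosed c {n} G = ∀ (x y : Fin n) → x ≢ y → c ≤ commonNbrs G x y → adj G x y ≡ true

numEdges : ∀ {n} → Graph n → ℕ
numEdges {n} G =
  countTrue (concatMap (λ x → map (λ y → ⌊ toℕ x <? toℕ y ⌋ ∧ adj G x y) (allFin n)) (allFin n))

allSubsets : (n : ℕ) → List (Subset n)
allSubsets zero    = [] ∷ []
allSubsets (suc n) = map (outside ∷_) (allSubsets n) ++ map (inside ∷_) (allSubsets n)

isCliqueB : ∀ {n} → Graph n → Subset n → Bool
isCliqueB {n} G s =
  and (concatMap (λ x → map (λ y →
         not (lookup s x ∧ lookup s y ∧ not ⌊ x ≟ y ⌋) ∨ adj G x y) (allFin n)) (allFin n))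

eqℕ : ℕ → ℕ → Bool
eqℕ zero    zero    = true
eqℕ zero    (suc _) = false
eqℕ (suc _) zero    = false
eqℕ (suc a) (suc b) = eqℕ a b

cliqueCount : ∀ {n} → Graph n → ℕ → ℕ
cliqueCount {n} G j = countTrue (map (λ s → eqℕ ∣ s ∣ j ∧ isCliqueB G s) (allSubsets n))

KFree : ℕ → ∀ {n} → Graph n → Set
KFree k G = cliqueCount G k ≡ 0

-- Write Tⱼ(U) for the number of sequences of j pairwise adjacent vertices of U (so Tⱼ = j! nⱼ on
-- the whole graph) and Qⱼ(U) for the sum of |U ∩ N x₁ ∩ ⋯ ∩ N xⱼ|² over these sequences.
-- Cauchy–Schwarz gives Tⱼ₊₁² ≤ Tⱼ Qⱼ. Expanding the square, Qⱼ(U) is the sum of Tⱼ(U ∩ N v ∩ N w)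
-- over pairs v, w of U: the diagonal contributes Tⱼ₊₁(U), adjacent pairs Tⱼ₊₂(U), and each
-- nonadjacent pair at most cʲ, as by c-closedness it has fewer than c common neighbours.
-- For j = 1 this reads Q₁(U) ≤ (1 + c)|U|² + T₃(U), and a second Cauchy–Schwarz over the first
-- vertex gives T₃(U)² ≤ A |U|² Q₁(U) whenever Q₁ ≤ A |·|² on the neighbourhoods, which are
-- K_{k-1}-free if U is K_k-free. Solving this quadratic inequality shows Q₁(U) = O(|U|²) by
-- induction on k; then e² ≤ T₂² ≤ n Q₁ = O(n³), every Tⱼ₊₁ = O(n²), and
-- nⱼ₊₁² ≤ Tⱼ₊₁² ≤ Tⱼ · O(n²) = O(nⱼ n²).

module Submission where

open import Data.Bool using (Bool; true; false; _∧_; _∨_; not)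
open import Data.Bool.ListAction using (and)
open import Data.Bool.Properties using (∧-idempotentCommutativeMonoid; ∧-identityʳ; ∧-zeroʳ; ⇔→≡)
open import Data.Empty using (⊥-elim)
open import Data.Fin using (Fin; zero; suc; toℕ)
import Data.Fin.Properties as Fin
open import Data.Fin.Subset using (Subset; inside; outside; ∣_∣)
open import Data.List using (List; []; _∷_; _++_; map; tabulate; concatMap; allFin)
open import Data.List.Properties using (map-++; map-cong; map-∘)
open import Data.Nat using (ℕ; zero; suc; _+_; _*_; _^_; _≤_; _<_; z≤n; _!; >-nonZero)
open import Data.Nat.Properties
open import Data.Nat.Tactic.RingSolver using (solve-∀)
open import Data.Product using (Σ; _×_; _,_; proj₁; proj₂)
open import Data.Product.Function.NonDependent.Propositional using (_×-⇔_)
open import Data.Sum using (inj₁; inj₂)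
open import Data.Vec using (_∷_; []; lookup)
open import Function using (_∘_; id)
open import Function.Bundles using (_⇔_; mk⇔; Equivalence)
import Function.Properties.Equivalence as ⇔
open import Relation.Binary.PropositionalEquality
open import Relation.Nullary using (does; yes; no; contradiction)
open import Relation.Nullary.Decidable using (⌊_⌋)
open import Algebra.Properties.CommutativeSemigroup *-commutativeSemigroup using (x∙yz≈y∙xz; x∙yz≈yx∙z)
open import Algebra.Properties.Semiring.Sum +-*-semiring
  using (sum; sum-cong-≗; ∑-distrib-+; ∑-comm; *-distribˡ-sum; *-distribʳ-sum)
open import Algebra.Solver.IdempotentCommutativeMonoid ∧-idempotentCommutativeMonoid
  using (solve; _⊜_; _⊕_)

open import Defs

𝟙 : Bool → ℕ
𝟙 true  = 1
𝟙 false = 0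

𝟙-∧ : ∀ p q → 𝟙 (p ∧ q) ≡ 𝟙 p * 𝟙 q
𝟙-∧ true  q = sym (+-identityʳ (𝟙 q))
𝟙-∧ false q = refl

𝟙-∧-exchange : ∀ p q r t → 𝟙 p * (𝟙 (q ∧ r) * t) ≡ 𝟙 (p ∧ r) * (𝟙 q * t)
𝟙-∧-exchange p q r t = begin
  𝟙 p * (𝟙 (q ∧ r) * t)  ≡⟨ cong (λ m → 𝟙 p * (m * t)) (𝟙-∧ q r) ⟩
  𝟙 p * (𝟙 q * 𝟙 r * t)  ≡⟨ exchange (𝟙 p) (𝟙 q) (𝟙 r) t ⟩
  𝟙 p * 𝟙 r * (𝟙 q * t)  ≡⟨ cong (_* (𝟙 q * t)) (𝟙-∧ p r) ⟨
  𝟙 (p ∧ r) * (𝟙 q * t)  ∎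
  where
  open ≡-Reasoning
  exchange : ∀ a b c t → a * (b * c * t) ≡ a * c * (b * t)
  exchange = solve-∀

∧-true⁻ : ∀ {p q} → p ∧ q ≡ true → p ≡ true × q ≡ true
∧-true⁻ {true} {true} _ = refl , refl

∧-true⁺ : ∀ {p q} → p ≡ true → q ≡ true → p ∧ q ≡ true
∧-true⁺ refl refl = refl

∧≡true⇔ : ∀ {p q} → p ∧ q ≡ true ⇔ (p ≡ true × q ≡ true)
∧≡true⇔ = mk⇔ ∧-true⁻ (λ (p , q) → ∧-true⁺ p q)

not∨≡true⇔ : ∀ {b p} → not b ∨ p ≡ true ⇔ (b ≡ true → p ≡ true)
not∨≡true⇔ {true}  = mk⇔ (λ p _ → p) (λ b⇒p → b⇒p refl)
not∨≡true⇔ {false} = mk⇔ (λ _ ()) (λ _ → refl)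

m*m≤n*n⇒m≤n : ∀ m n → m * m ≤ n * n → m ≤ n
m*m≤n*n⇒m≤n m n m²≤n² with m ≤? n
... | yes m≤n = m≤n
... | no  m≰n = ⊥-elim (<⇒≱ (*-mono-< (≰⇒> m≰n) (≰⇒> m≰n)) m²≤n²)

am-gm-≤ : ∀ {m n} → m ≤ n → 4 * (m * n) ≤ (m + n) * (m + n)
am-gm-≤ {m} m≤n with d , refl ← m≤n⇒∃[o]m+o≡n m≤n =
  ≤-trans (m≤m+n _ (d * d)) (≤-reflexive (expand m d))
  where
  expand : ∀ m d → 4 * (m * (m + d)) + d * d ≡ (m + (m + d)) * (m + (m + d))
  expand = solve-∀

am-gm : ∀ m n → 4 * (m * n) ≤ (m + n) * (m + n)
am-gm m n with ≤-total m n
... | inj₁ m≤n = am-gm-≤ m≤n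
... | inj₂ n≤m = subst₂ _≤_ (cong (4 *_) (*-comm n m)) (cong₂ _*_ (+-comm n m) (+-comm n m)) (am-gm-≤ n≤m)

-- AM-GM applied to b C and B c, whose product is at least (a A)².
2aA≤bC+Bc : ∀ {a b c A B C} → a * a ≤ b * c → A * A ≤ B * C → 2 * (a * A) ≤ b * C + B * c
2aA≤bC+Bc {a} {b} {c} {A} {B} {C} a²≤bc A²≤BC = m*m≤n*n⇒m≤n _ _ (begin
  2 * (a * A) * (2 * (a * A))  ≡⟨ square-2aA a A ⟩
  4 * ((a * a) * (A * A))      ≤⟨ *-monoʳ-≤ 4 (*-mono-≤ a²≤bc A²≤BC) ⟩
  4 * ((b * c) * (B * C))      ≡⟨ cong (4 *_) (regroup b c B C) ⟩
  4 * ((b * C) * (B * c))      ≤⟨ am-gm (b * C) (B * c) ⟩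
  (b * C + B * c) * (b * C + B * c) ∎)
  where
  open ≤-Reasoning
  square-2aA : ∀ a A → 2 * (a * A) * (2 * (a * A)) ≡ 4 * ((a * a) * (A * A))
  square-2aA = solve-∀
  regroup : ∀ b c B C → (b * c) * (B * C) ≡ (b * C) * (B * c)
  regroup = solve-∀

-- Either f ≤ 2K, or f < 2T and then f² < 4T² ≤ 4Af.
quadratic-self-bound : ∀ f K T A → f ≤ K + T → T * T ≤ A * f → f ≤ 2 * K + 4 * A
quadratic-self-bound f K T A f≤K+T T²≤Af with f ≤? 2 * K
... | yes f≤2K = ≤-trans f≤2K (m≤m+n _ _)
... | no  f≰2K = ≤-trans f≤4A (m≤n+m (4 * A) (2 * K))
  where
  open ≤-Reasoning
  f<2T : f < 2 * T
  f<2T = +-cancelˡ-< f f (2 * T) (begin-strict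
    f + f         ≡⟨ cong (f +_) (sym (+-identityʳ f)) ⟩
    2 * f         ≤⟨ *-monoʳ-≤ 2 f≤K+T ⟩
    2 * (K + T)   ≡⟨ *-distribˡ-+ 2 K T ⟩
    2 * K + 2 * T <⟨ +-monoˡ-< (2 * T) (≰⇒> f≰2K) ⟩
    f + 2 * T     ∎)
  f≤4A : f ≤ 4 * A
  f≤4A = *-cancelʳ-≤ f (4 * A) f {{>-nonZero (≤-<-trans z≤n (≰⇒> f≰2K))}} (begin
    f * f           ≤⟨ *-mono-≤ (<⇒≤ f<2T) (<⇒≤ f<2T) ⟩
    2 * T * (2 * T) ≡⟨ square-2T T ⟩
    4 * (T * T)     ≤⟨ *-monoʳ-≤ 4 T²≤Af ⟩
    4 * (A * f)     ≡⟨ sym (*-assoc 4 A f) ⟩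
    4 * A * f       ∎)
    where
    square-2T : ∀ T → 2 * T * (2 * T) ≡ 4 * (T * T)
    square-2T = solve-∀

∑-mono-≤ : ∀ {n} {f g : Fin n → ℕ} → (∀ i → f i ≤ g i) → sum f ≤ sum g
∑-mono-≤ {zero}  _   = z≤n
∑-mono-≤ {suc n} f≤g = +-mono-≤ (f≤g zero) (∑-mono-≤ (f≤g ∘ suc))

∑-const : ∀ n k → sum {n} (λ _ → k) ≡ n * k
∑-const zero    k = refl
∑-const (suc n) k = cong (k +_) (∑-const n k)

∑-CauchySchwarz : ∀ {n} (a b c : Fin n → ℕ) → (∀ i → a i * a i ≤ b i * c i) →
                  sum a * sum a ≤ sum b * sum c
∑-CauchySchwarz {zero}  a b c _ = z≤n
∑-CauchySchwarz {suc n} a b c a²≤bc = begin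
  (a₀ + ∑a) * (a₀ + ∑a)                   ≡⟨ expand a₀ ∑a ⟩
  a₀ * a₀ + 2 * (a₀ * ∑a) + ∑a * ∑a       ≤⟨ +-mono-≤ (+-mono-≤ (a²≤bc zero) cross) ih ⟩
  b₀ * c₀ + (b₀ * ∑c + ∑b * c₀) + ∑b * ∑c ≡⟨ factor b₀ c₀ ∑b ∑c ⟩
  (b₀ + ∑b) * (c₀ + ∑c)                   ∎
  where
  open ≤-Reasoning
  a₀ = a zero
  b₀ = b zero
  c₀ = c zero
  ∑a = sum (a ∘ suc)
  ∑b = sum (b ∘ suc)
  ∑c = sum (c ∘ suc)
  ih = ∑-CauchySchwarz (a ∘ suc) (b ∘ suc) (c ∘ suc) (a²≤bc ∘ suc)
  cross = 2aA≤bC+Bc {a₀} {b₀} {c₀} {∑a} {∑b} {∑c} (a²≤bc zero) ih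
  expand : ∀ a s → (a + s) * (a + s) ≡ a * a + 2 * (a * s) + s * s
  expand = solve-∀
  factor : ∀ b c sb sc → b * c + (b * sc + sb * c) + sb * sc ≡ (b + sb) * (c + sc)
  factor = solve-∀

countTrue-map-tabulate : ∀ {n} {A : Set} (f : A → Bool) (g : Fin n → A) →
                         countTrue (map f (tabulate g)) ≡ sum (λ i → 𝟙 (f (g i)))
countTrue-map-tabulate {zero}  f g = refl
countTrue-map-tabulate {suc n} f g with f (g zero)
... | true  = cong suc (countTrue-map-tabulate f (g ∘ suc))
... | false = countTrue-map-tabulate f (g ∘ suc)

countTrue-++ : ∀ xs ys → countTrue (xs ++ ys) ≡ countTrue xs + countTrue ys
countTrue-++ []           ys = refl
countTrue-++ (true  ∷ xs) ys = cong suc (countTrue-++ xs ys)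
countTrue-++ (false ∷ xs) ys = countTrue-++ xs ys

countTrue-concatMap-tabulate : ∀ {n} {A : Set} (F : A → List Bool) (g : Fin n → A) →
  countTrue (concatMap F (tabulate g)) ≡ sum (λ i → countTrue (F (g i)))
countTrue-concatMap-tabulate {zero}  F g = refl
countTrue-concatMap-tabulate {suc n} F g =
  trans (countTrue-++ (F (g zero)) _) (cong (countTrue (F (g zero)) +_) (countTrue-concatMap-tabulate F (g ∘ suc)))

countTrue-cong : ∀ {A : Set} {P Q : A → Bool} → (∀ x → P x ≡ Q x) →
                 ∀ xs → countTrue (map P xs) ≡ countTrue (map Q xs)
countTrue-cong P≗Q xs = cong countTrue (map-cong P≗Q xs)

countTrue-map-false : ∀ {A : Set} (xs : List A) → countTrue (map (λ _ → false) xs) ≡ 0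
countTrue-map-false []       = refl
countTrue-map-false (_ ∷ xs) = countTrue-map-false xs

countTrue-∧ˡ : ∀ {A : Set} b (P : A → Bool) xs →
               countTrue (map (λ x → b ∧ P x) xs) ≡ 𝟙 b * countTrue (map P xs)
countTrue-∧ˡ true  P xs = sym (+-identityʳ _)
countTrue-∧ˡ false P xs = countTrue-map-false xs

countTrue-allSubsets-suc : ∀ {n} (P : Subset (suc n) → Bool) → countTrue (map P (allSubsets (suc n))) ≡
  countTrue (map (P ∘ (outside ∷_)) (allSubsets n)) + countTrue (map (P ∘ (inside ∷_)) (allSubsets n))
countTrue-allSubsets-suc {n} P = begin
  countTrue (map P (map (outside ∷_) S ++ map (inside ∷_) S))
    ≡⟨ cong countTrue (map-++ P (map (outside ∷_) S) (map (inside ∷_) S)) ⟩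
  countTrue (map P (map (outside ∷_) S) ++ map P (map (inside ∷_) S))
    ≡⟨ countTrue-++ (map P (map (outside ∷_) S)) _ ⟩
  countTrue (map P (map (outside ∷_) S)) + countTrue (map P (map (inside ∷_) S))
    ≡⟨ cong₂ _+_ (cong countTrue (map-∘ S)) (cong countTrue (map-∘ S)) ⟨
  countTrue (map (P ∘ (outside ∷_)) S) + countTrue (map (P ∘ (inside ∷_)) S) ∎
  where
  open ≡-Reasoning
  S = allSubsets n

and-++ : ∀ xs ys → and (xs ++ ys) ≡ and xs ∧ and ys
and-++ []           ys = refl
and-++ (true  ∷ xs) ys = and-++ xs ys
and-++ (false ∷ xs) ys = refl

and-concatMap : ∀ {A : Set} (F : A → List Bool) xs → and (concatMap F xs) ≡ and (map (and ∘ F) xs)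
and-concatMap F []       = refl
and-concatMap F (x ∷ xs) = trans (and-++ (F x) (concatMap F xs)) (cong (and (F x) ∧_) (and-concatMap F xs))

and-map-tabulate⇔ : ∀ {n} {A : Set} (f : A → Bool) (g : Fin n → A) →
                    and (map f (tabulate g)) ≡ true ⇔ (∀ i → f (g i) ≡ true)
and-map-tabulate⇔ f g = mk⇔ (to f g) (from f g)
  where
  to : ∀ {n} {A : Set} (f : A → Bool) (g : Fin n → A) →
       and (map f (tabulate g)) ≡ true → ∀ i → f (g i) ≡ true
  to f g all≡true zero    = proj₁ (∧-true⁻ all≡true)
  to f g all≡true (suc i) = to f (g ∘ suc) (proj₂ (∧-true⁻ {f (g zero)} all≡true)) i
  from : ∀ {n} {A : Set} (f : A → Bool) (g : Fin n → A) →
         (∀ i → f (g i) ≡ true) → and (map f (tabulate g)) ≡ true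
  from {zero}  f g _      = refl
  from {suc n} f g f≡true = ∧-true⁺ (f≡true zero) (from f (g ∘ suc) (f≡true ∘ suc))

-- Sums over vertex sets

VSet : ℕ → Set
VSet n = Fin n → Bool

∑∈ : ∀ {n} → VSet n → (Fin n → ℕ) → ℕ
∑∈ U f = sum (λ x → 𝟙 (U x) * f x)

infixl 10 ∑∈
syntax ∑∈ U (λ x → e) = ∑[ x ∈ U ] e

module _ {n : ℕ} where

  size : VSet n → ℕ
  size U = ∑[ x ∈ U ] 1

  full : VSet n
  full _ = true

  infixl 8 _∩_
  _∩_ : VSet n → VSet n → VSet n
  (U ∩ V) x = U x ∧ V x

  ⁅_⁆ : Fin n → VSet n
  ⁅ u ⁆ w = does (u Fin.≟ w)

  ∑∈-cong : ∀ U {f g : Fin n → ℕ} → (∀ x → f x ≡ g x) → ∑∈ U f ≡ ∑∈ U g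
  ∑∈-cong U f≗g = sum-cong-≗ (λ x → cong (𝟙 (U x) *_) (f≗g x))

  ∑∈-mono-≤ : ∀ U {f g : Fin n → ℕ} → (∀ x → U x ≡ true → f x ≤ g x) → ∑∈ U f ≤ ∑∈ U g
  ∑∈-mono-≤ U {f} {g} f≤g = ∑-mono-≤ guarded
    where
    guarded : ∀ x → 𝟙 (U x) * f x ≤ 𝟙 (U x) * g x
    guarded x with U x in x∈U
    ... | true  = *-monoʳ-≤ 1 (f≤g x x∈U)
    ... | false = z≤n

  ∑∈-+ : ∀ U (f g : Fin n → ℕ) → ∑[ x ∈ U ] (f x + g x) ≡ ∑∈ U f + ∑∈ U g
  ∑∈-+ U f g = trans (sum-cong-≗ (λ x → *-distribˡ-+ (𝟙 (U x)) (f x) (g x)))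
                     (∑-distrib-+ (λ x → 𝟙 (U x) * f x) (λ x → 𝟙 (U x) * g x))

  *-distribˡ-∑∈ : ∀ k U (f : Fin n → ℕ) → k * ∑∈ U f ≡ ∑[ x ∈ U ] (k * f x)
  *-distribˡ-∑∈ k U f = trans (*-distribˡ-sum k (λ x → 𝟙 (U x) * f x))
                              (sum-cong-≗ (λ x → x∙yz≈y∙xz k (𝟙 (U x)) (f x)))

  ∑∈-const : ∀ U k → ∑[ x ∈ U ] k ≡ size U * k
  ∑∈-const U k = sym (trans (*-distribʳ-sum k (λ x → 𝟙 (U x) * 1))
                            (sum-cong-≗ (λ x → cong (_* k) (*-identityʳ (𝟙 (U x))))))

  ∑∈-∩ : ∀ U V (f : Fin n → ℕ) → ∑∈ (U ∩ V) f ≡ ∑[ x ∈ U ] (𝟙 (V x) * f x)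
  ∑∈-∩ U V f = sum-cong-≗ (λ x →
    trans (cong (_* f x) (𝟙-∧ (U x) (V x))) (*-assoc (𝟙 (U x)) (𝟙 (V x)) (f x)))

  ∑∈-comm : ∀ U V (f : Fin n → Fin n → ℕ) → ∑[ x ∈ U ] ∑[ y ∈ V ] f x y ≡ ∑[ y ∈ V ] ∑[ x ∈ U ] f x y
  ∑∈-comm U V f = begin
    sum (λ x → 𝟙 (U x) * sum (λ y → 𝟙 (V y) * f x y))
      ≡⟨ sum-cong-≗ (λ x → *-distribˡ-sum (𝟙 (U x)) (λ y → 𝟙 (V y) * f x y)) ⟩
    sum {n} (λ x → sum {n} (λ y → 𝟙 (U x) * (𝟙 (V y) * f x y)))
      ≡⟨ ∑-comm {n} {n} (λ x y → 𝟙 (U x) * (𝟙 (V y) * f x y)) ⟩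
    sum {n} (λ y → sum {n} (λ x → 𝟙 (U x) * (𝟙 (V y) * f x y)))
      ≡⟨ sum-cong-≗ (λ y → sum-cong-≗ (λ x → x∙yz≈y∙xz (𝟙 (U x)) (𝟙 (V y)) (f x y))) ⟩
    sum {n} (λ y → sum {n} (λ x → 𝟙 (V y) * (𝟙 (U x) * f x y)))
      ≡⟨ sum-cong-≗ (λ y → *-distribˡ-sum (𝟙 (V y)) (λ x → 𝟙 (U x) * f x y)) ⟨
    sum (λ y → 𝟙 (V y) * sum (λ x → 𝟙 (U x) * f x y))
      ∎
    where open ≡-Reasoning

  ∑∈≡0⇒≡0 : ∀ U (f : Fin n → ℕ) → ∑∈ U f ≡ 0 → ∀ x → U x ≡ true → f x ≡ 0
  ∑∈≡0⇒≡0 U f ∑≡0 x x∈U =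
    trans (sym (+-identityʳ (f x))) (subst (λ b → 𝟙 b * f x ≡ 0) x∈U (summand≡0 ∑≡0 x))
    where
    summand≡0 : ∀ {m} {g : Fin m → ℕ} → sum g ≡ 0 → ∀ i → g i ≡ 0
    summand≡0 {suc m} {g} ∑g≡0 zero    = m+n≡0⇒m≡0 (g zero) ∑g≡0
    summand≡0 {suc m} {g} ∑g≡0 (suc i) = summand≡0 (m+n≡0⇒n≡0 (g zero) ∑g≡0) i

  ∑∈-CauchySchwarz : ∀ U (a b c : Fin n → ℕ) → (∀ x → U x ≡ true → a x * a x ≤ b x * c x) →
                     ∑∈ U a * ∑∈ U a ≤ ∑∈ U b * ∑∈ U c
  ∑∈-CauchySchwarz U a b c a²≤bc = ∑-CauchySchwarz _ _ _ guarded
    where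
    guarded : ∀ x → 𝟙 (U x) * a x * (𝟙 (U x) * a x) ≤ 𝟙 (U x) * b x * (𝟙 (U x) * c x)
    guarded x with U x in x∈U
    ... | false = z≤n
    ... | true rewrite *-identityˡ (a x) | *-identityˡ (b x) | *-identityˡ (c x) = a²≤bc x x∈U

  size-mono : ∀ {U V} → (∀ x → U x ≡ true → V x ≡ true) → size U ≤ size V
  size-mono {U} {V} U⊆V = ∑-mono-≤ (λ x → *-monoˡ-≤ 1 (𝟙-mono (U⊆V x)))
    where
    𝟙-mono : ∀ {p q} → (p ≡ true → q ≡ true) → 𝟙 p ≤ 𝟙 q
    𝟙-mono {true}  p⇒q rewrite p⇒q refl = ≤-refl
    𝟙-mono {false} _ = z≤n

  size-∩ : ∀ U V → size (U ∩ V) ≤ size U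
  size-∩ U V = size-mono {U ∩ V} {U} (λ x → proj₁ ∘ ∧-true⁻)

∑∈-singleton : ∀ {n} (u : Fin n) (f : Fin n → ℕ) → ∑∈ ⁅ u ⁆ f ≡ f u
∑∈-singleton {suc n} zero    f =
  trans (cong₂ _+_ (*-identityˡ (f zero)) (trans (∑-const n 0) (*-zeroʳ n))) (+-identityʳ _)
∑∈-singleton {suc n} (suc u) f = ∑∈-singleton u (f ∘ suc)

size-full : ∀ n → size (full {n}) ≡ n
size-full n = trans (∑-const n 1) (*-identityʳ n)

sizeSq : ∀ {n} → VSet n → ℕ
sizeSq V = size V * size V

-- Ordered cliques

module _ {n : ℕ} (G : Graph n) where

  N : Fin n → VSet n
  N = adj G

  -- cliqueSum U j φ is the sum of φ (U ∩ N x₁ ∩ ⋯ ∩ N xⱼ) over the sequences x₁, …, xⱼ of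
  -- pairwise adjacent (hence distinct) vertices of U.
  cliqueSum : VSet n → ℕ → (VSet n → ℕ) → ℕ
  cliqueSum U zero    φ = φ U
  cliqueSum U (suc j) φ = ∑[ x ∈ U ] cliqueSum (U ∩ N x) j φ

  orderedCliques : VSet n → ℕ → ℕ
  orderedCliques U j = cliqueSum U j (λ _ → 1)

  orderedCliques-cong : ∀ j {U V} → (∀ x → U x ≡ V x) → orderedCliques U j ≡ orderedCliques V j
  orderedCliques-cong zero    _   = refl
  orderedCliques-cong (suc j) U≗V = sum-cong-≗ (λ x →
    cong₂ _*_ (cong 𝟙 (U≗V x)) (orderedCliques-cong j (λ y → cong (_∧ adj G x y) (U≗V y))))

  orderedCliques≤size^ : ∀ j U → orderedCliques U j ≤ size U ^ j
  orderedCliques≤size^ zero    U = ≤-refl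
  orderedCliques≤size^ (suc j) U = begin
    ∑[ x ∈ U ] orderedCliques (U ∩ N x) j
      ≤⟨ ∑∈-mono-≤ U (λ x _ → ≤-trans (orderedCliques≤size^ j (U ∩ N x)) (^-monoˡ-≤ j (size-∩ U (N x)))) ⟩
    ∑[ x ∈ U ] (size U ^ j)
      ≡⟨ ∑∈-const U (size U ^ j) ⟩
    size U * size U ^ j
      ∎
    where open ≤-Reasoning

  orderedCliques-∩N≡0 : ∀ k U → orderedCliques U (suc k) ≡ 0 →
                        ∀ x → U x ≡ true → orderedCliques (U ∩ N x) k ≡ 0
  orderedCliques-∩N≡0 k U = ∑∈≡0⇒≡0 U (λ x → orderedCliques (U ∩ N x) k)

  cliqueSum-size : ∀ j U → cliqueSum U j size ≡ orderedCliques U (suc j)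
  cliqueSum-size zero    U = refl
  cliqueSum-size (suc j) U = ∑∈-cong U (λ x → cliqueSum-size j (U ∩ N x))

  cliqueSum-CauchySchwarz : ∀ j U φ →
    cliqueSum U j φ * cliqueSum U j φ ≤ orderedCliques U j * cliqueSum U j (λ V → φ V * φ V)
  cliqueSum-CauchySchwarz zero    U φ = ≤-reflexive (sym (*-identityˡ _))
  cliqueSum-CauchySchwarz (suc j) U φ =
    ∑∈-CauchySchwarz U _ _ _ (λ x _ → cliqueSum-CauchySchwarz j (U ∩ N x) φ)

  cliqueSum-sizeSq : ∀ j U →
    cliqueSum U j sizeSq ≡ ∑[ v ∈ U ] ∑[ w ∈ U ] orderedCliques (U ∩ N v ∩ N w) j
  cliqueSum-sizeSq zero    U = sym (∑∈-const U (size U))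
  cliqueSum-sizeSq (suc j) U = begin
    ∑[ x ∈ U ] cliqueSum (U ∩ N x) j sizeSq
      ≡⟨ ∑∈-cong U (λ x → trans (cliqueSum-sizeSq j (U ∩ N x)) (unfold x)) ⟩
    ∑[ x ∈ U ] ∑[ v ∈ U ] ∑[ w ∈ U ] (𝟙 (adj G x v) * (𝟙 (adj G x w) * T[ U ∩ N x ∩ N v ∩ N w ]))
      ≡⟨ ∑∈-comm U U _ ⟩
    ∑[ v ∈ U ] ∑[ x ∈ U ] ∑[ w ∈ U ] (𝟙 (adj G x v) * (𝟙 (adj G x w) * T[ U ∩ N x ∩ N v ∩ N w ]))
      ≡⟨ ∑∈-cong U (λ v → trans (∑∈-comm U U _) (∑∈-cong U (λ w → fold v w))) ⟩
    ∑[ v ∈ U ] ∑[ w ∈ U ] ∑[ x ∈ U ∩ N v ∩ N w ] T[ U ∩ N v ∩ N w ∩ N x ] ∎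
    where
    open ≡-Reasoning
    T[_] : VSet n → ℕ
    T[ V ] = orderedCliques V j
    unfold : ∀ x → ∑[ v ∈ U ∩ N x ] ∑[ w ∈ U ∩ N x ] T[ U ∩ N x ∩ N v ∩ N w ]
                 ≡ ∑[ v ∈ U ] ∑[ w ∈ U ] (𝟙 (adj G x v) * (𝟙 (adj G x w) * T[ U ∩ N x ∩ N v ∩ N w ]))
    unfold x = trans (∑∈-∩ U (N x) _) (∑∈-cong U (λ v →
      trans (cong (𝟙 (adj G x v) *_) (∑∈-∩ U (N x) _)) (*-distribˡ-∑∈ (𝟙 (adj G x v)) U _)))
    fold : ∀ v w → ∑[ x ∈ U ] (𝟙 (adj G x v) * (𝟙 (adj G x w) * T[ U ∩ N x ∩ N v ∩ N w ]))
                 ≡ ∑[ x ∈ U ∩ N v ∩ N w ] T[ U ∩ N v ∩ N w ∩ N x ]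
    fold v w = sym (begin
      ∑[ x ∈ U ∩ N v ∩ N w ] T[ U ∩ N v ∩ N w ∩ N x ]
        ≡⟨ trans (∑∈-∩ (U ∩ N v) (N w) _) (∑∈-∩ U (N v) _) ⟩
      ∑[ x ∈ U ] (𝟙 (adj G v x) * (𝟙 (adj G w x) * T[ U ∩ N v ∩ N w ∩ N x ]))
        ≡⟨ ∑∈-cong U (λ x → cong₂ (λ p q → 𝟙 p * (𝟙 q * T[ U ∩ N v ∩ N w ∩ N x ]))
                                   (symm G v x) (symm G w x)) ⟩
      ∑[ x ∈ U ] (𝟙 (adj G x v) * (𝟙 (adj G x w) * T[ U ∩ N v ∩ N w ∩ N x ]))
        ≡⟨ ∑∈-cong U (λ x → cong (λ t → 𝟙 (adj G x v) * (𝟙 (adj G x w) * t))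
             (orderedCliques-cong j (λ y → reorder (U y) (adj G v y) (adj G w y) (adj G x y)))) ⟩
      ∑[ x ∈ U ] (𝟙 (adj G x v) * (𝟙 (adj G x w) * T[ U ∩ N x ∩ N v ∩ N w ])) ∎)
      where
      reorder : ∀ p q r s → ((p ∧ q) ∧ r) ∧ s ≡ ((p ∧ s) ∧ q) ∧ r
      reorder = solve 4 (λ p q r s → ((p ⊕ q) ⊕ r) ⊕ s ⊜ ((p ⊕ s) ⊕ q) ⊕ r) refl

  ∑∈-split : ∀ U u (f : Fin n → ℕ) M → (∀ w → u ≢ w → adj G u w ≡ false → f w ≤ M) →
             ∑∈ U f ≤ f u + ∑∈ (U ∩ N u) f + size U * M
  ∑∈-split U u f M far⇒≤M = begin
    ∑∈ U f
      ≤⟨ ∑-mono-≤ pointwise ⟩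
    sum (λ w → 𝟙 (⁅ u ⁆ w) * f w + 𝟙 ((U ∩ N u) w) * f w + 𝟙 (U w) * M)
      ≡⟨ trans (∑-distrib-+ (λ w → diagonal w + adjacent w) (λ w → 𝟙 (U w) * M))
               (cong (_+ ∑[ w ∈ U ] M) (∑-distrib-+ diagonal adjacent)) ⟩
    ∑∈ ⁅ u ⁆ f + ∑∈ (U ∩ N u) f + ∑[ w ∈ U ] M
      ≡⟨ cong₂ _+_ (cong (_+ ∑∈ (U ∩ N u) f) (∑∈-singleton u f)) (∑∈-const U M) ⟩
    f u + ∑∈ (U ∩ N u) f + size U * M ∎
    where
    open ≤-Reasoning
    diagonal adjacent : Fin n → ℕ
    diagonal w = 𝟙 (⁅ u ⁆ w) * f w
    adjacent w = 𝟙 ((U ∩ N u) w) * f w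
    pointwise : ∀ w → 𝟙 (U w) * f w ≤ diagonal w + adjacent w + 𝟙 (U w) * M
    pointwise w with u Fin.≟ w
    ... | yes refl = ≤-trans (*-monoˡ-≤ (f u) (𝟙≤1 (U u))) (≤-trans (m≤m+n _ _) (m≤m+n _ _))
      where
      𝟙≤1 : ∀ b → 𝟙 b ≤ 1
      𝟙≤1 true  = ≤-refl
      𝟙≤1 false = z≤n
    ... | no u≢w with adj G u w in uw
    ...   | true  rewrite ∧-identityʳ (U w) = m≤m+n _ _
    ...   | false = ≤-trans (*-monoʳ-≤ (𝟙 (U w)) (far⇒≤M w u≢w uw)) (m≤n+m _ _)

  size-∩N∩N≤commonNbrs : ∀ U u w → size (U ∩ N u ∩ N w) ≤ commonNbrs G u w
  size-∩N∩N≤commonNbrs U u w = begin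
    size (U ∩ N u ∩ N w)       ≤⟨ size-mono {U = U ∩ N u ∩ N w} common ⟩
    size {n} uw-path           ≡⟨ sum-cong-≗ (λ z → *-identityʳ (𝟙 (uw-path z))) ⟩
    sum (λ z → 𝟙 (uw-path z))  ≡⟨ countTrue-map-tabulate uw-path id ⟨
    commonNbrs G u w           ∎
    where
    open ≤-Reasoning
    uw-path : VSet n
    uw-path z = adj G u z ∧ adj G z w
    common : ∀ z → (U z ∧ adj G u z) ∧ adj G w z ≡ true → uw-path z ≡ true
    common z z∈U∩Nu∩Nw with z∈U∩Nu , wz ← ∧-true⁻ z∈U∩Nu∩Nw =
      ∧-true⁺ (proj₂ (∧-true⁻ z∈U∩Nu)) (trans (symm G z w) wz)

-- Closed graphs

-- Only k ≥ 1 matters below: orderedCliques U 0 = 1, so no vertex set is K₀-free.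
degreeSqConst : ℕ → ℕ → ℕ
degreeSqConst c zero    = 0
degreeSqConst c (suc k) = 2 * (1 + c) + 4 * degreeSqConst c k

cliqueConst : ℕ → ℕ → ℕ → ℕ
cliqueConst c k       zero    = 1
cliqueConst c zero    (suc j) = 0
cliqueConst c (suc k) (suc j) = degreeSqConst c (suc k) * cliqueConst c k j

module _ {n c : ℕ} {G : Graph n} (closed : CClosed c G) where

  commonNbrs<c : ∀ u w → u ≢ w → adj G u w ≡ false → commonNbrs G u w < c
  commonNbrs<c u w u≢w uw≡false with c ≤? commonNbrs G u w
  ... | yes c≤ = contradiction (trans (sym uw≡false) (closed u w u≢w c≤)) (λ ())
  ... | no  c≰ = ≰⇒> c≰

  cliqueSum-sizeSq-bound : ∀ j U → cliqueSum G U j sizeSq ≤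
    orderedCliques G U (suc j) + orderedCliques G U (suc (suc j)) + size U * (size U * c ^ j)
  cliqueSum-sizeSq-bound j U = begin
    cliqueSum G U j sizeSq
      ≡⟨ cliqueSum-sizeSq G j U ⟩
    ∑[ v ∈ U ] ∑[ w ∈ U ] T[ U ∩ N G v ∩ N G w ]
      ≤⟨ ∑∈-mono-≤ U (λ v _ → ∑∈-split G U v (λ w → T[ U ∩ N G v ∩ N G w ]) (c ^ j) (far v)) ⟩
    ∑[ v ∈ U ] (T[ U ∩ N G v ∩ N G v ] + ∑[ w ∈ U ∩ N G v ] T[ U ∩ N G v ∩ N G w ] + size U * c ^ j)
      ≡⟨ trans (∑∈-+ U (λ v → diagonal v + adjacent v) (λ _ → size U * c ^ j))
               (cong (_+ ∑[ v ∈ U ] (size U * c ^ j)) (∑∈-+ U diagonal adjacent)) ⟩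
    ∑∈ U diagonal + orderedCliques G U (suc (suc j)) + ∑[ v ∈ U ] (size U * c ^ j)
      ≡⟨ cong₂ _+_ (cong (_+ orderedCliques G U (suc (suc j)))
                     (∑∈-cong U (λ v → orderedCliques-cong G j (λ y → ∧-idemʳ (U y) (adj G v y)))))
                   (∑∈-const U (size U * c ^ j)) ⟩
    orderedCliques G U (suc j) + orderedCliques G U (suc (suc j)) + size U * (size U * c ^ j) ∎
    where
    open ≤-Reasoning
    T[_] : VSet n → ℕ
    T[ V ] = orderedCliques G V j
    diagonal adjacent : Fin n → ℕ
    diagonal v = T[ U ∩ N G v ∩ N G v ]
    adjacent v = ∑[ w ∈ U ∩ N G v ] T[ U ∩ N G v ∩ N G w ]
    ∧-idemʳ : ∀ p q → (p ∧ q) ∧ q ≡ p ∧ q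
    ∧-idemʳ = solve 2 (λ p q → (p ⊕ q) ⊕ q ⊜ p ⊕ q) refl
    far : ∀ v w → v ≢ w → adj G v w ≡ false → T[ U ∩ N G v ∩ N G w ] ≤ c ^ j
    far v w v≢w vw≡false = ≤-trans (orderedCliques≤size^ G j _) (^-monoˡ-≤ j
      (≤-trans (size-∩N∩N≤commonNbrs G U v w) (<⇒≤ (commonNbrs<c v w v≢w vw≡false))))

  degreeSqSum-bound : ∀ k U → orderedCliques G U k ≡ 0 →
                      cliqueSum G U 1 sizeSq ≤ degreeSqConst c k * sizeSq U
  degreeSqSum-bound zero    U ()
  degreeSqSum-bound (suc k) U free =
    ≤-trans (quadratic-self-bound Q (m * m + m * (m * c)) T₃ (m * m * A) Q≤ T₃²≤)
            (≤-reflexive (collect m c A))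
    where
    open ≤-Reasoning
    m = size U
    A = degreeSqConst c k
    Q = cliqueSum G U 1 sizeSq
    T₃ = orderedCliques G U 3
    collect : ∀ m c A →
              2 * (m * m + m * (m * c)) + 4 * (m * m * A) ≡ (2 * (1 + c) + 4 * A) * (m * m)
    collect = solve-∀
    Q≤ : Q ≤ m * m + m * (m * c) + T₃
    Q≤ = begin
      Q                                              ≤⟨ cliqueSum-sizeSq-bound 1 U ⟩
      orderedCliques G U 2 + T₃ + m * (m * (c * 1))  ≤⟨ +-monoˡ-≤ _ (+-monoˡ-≤ T₃ T₂≤m²) ⟩
      m * (m * 1) + T₃ + m * (m * (c * 1))           ≡⟨ reorder m c T₃ ⟩
      m * m + m * (m * c) + T₃                       ∎
      where
      T₂≤m² = orderedCliques≤size^ G 2 U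
      reorder : ∀ m c T → m * (m * 1) + T + m * (m * (c * 1)) ≡ m * m + m * (m * c) + T
      reorder = solve-∀
    T₂[_] : VSet n → ℕ
    T₂[ V ] = orderedCliques G V 2
    T₂²≤ : ∀ x → U x ≡ true → T₂[ U ∩ N G x ] * T₂[ U ∩ N G x ] ≤ m * A * sizeSq (U ∩ N G x)
    T₂²≤ x x∈U = begin
      T₂[ V ] * T₂[ V ]                            ≡⟨ cong (λ t → t * t) (cliqueSum-size G 1 V) ⟨
      cliqueSum G V 1 size * cliqueSum G V 1 size  ≤⟨ cliqueSum-CauchySchwarz G 1 V size ⟩
      size V * cliqueSum G V 1 sizeSq              ≤⟨ *-mono-≤ (size-∩ U (N G x)) (degreeSqSum-bound k V V-free) ⟩
      m * (A * sizeSq V)                           ≡⟨ *-assoc m A (sizeSq V) ⟨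
      m * A * sizeSq V                             ∎
      where
      V = U ∩ N G x
      V-free = orderedCliques-∩N≡0 G k U free x x∈U
    T₃²≤ : T₃ * T₃ ≤ m * m * A * Q
    T₃²≤ = begin
      T₃ * T₃
        ≤⟨ ∑∈-CauchySchwarz U _ (λ _ → 1) _ (λ x _ → ≤-reflexive (sym (*-identityˡ _))) ⟩
      m * ∑[ x ∈ U ] (T₂[ U ∩ N G x ] * T₂[ U ∩ N G x ])
        ≤⟨ *-monoʳ-≤ m (∑∈-mono-≤ U T₂²≤) ⟩
      m * ∑[ x ∈ U ] (m * A * sizeSq (U ∩ N G x))
        ≡⟨ cong (m *_) (*-distribˡ-∑∈ (m * A) U _) ⟨
      m * (m * A * Q)
        ≡⟨ regroup m A Q ⟩
      m * m * A * Q
        ∎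
      where
      regroup : ∀ m A Q → m * (m * A * Q) ≡ m * m * A * Q
      regroup = solve-∀

  orderedCliques-bound : ∀ k j U → orderedCliques G U k ≡ 0 →
                         orderedCliques G U (suc j) ≤ cliqueConst c k j * sizeSq U
  orderedCliques-bound k       zero    U _    = ≤-trans (m≤m*m (size U)) (≤-reflexive (sym (*-identityˡ _)))
    where
    m≤m*m : ∀ m → m ≤ m * m
    m≤m*m zero    = z≤n
    m≤m*m (suc m) = m≤m*n (suc m) (suc m)
  orderedCliques-bound zero    (suc j) U ()
  orderedCliques-bound (suc k) (suc j) U free = begin
    ∑[ x ∈ U ] orderedCliques G (U ∩ N G x) (suc j)
      ≤⟨ ∑∈-mono-≤ U (λ x x∈U →
           orderedCliques-bound k j (U ∩ N G x) (orderedCliques-∩N≡0 G k U free x x∈U)) ⟩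
    ∑[ x ∈ U ] (D * sizeSq (U ∩ N G x))  ≡⟨ *-distribˡ-∑∈ D U _ ⟨
    D * cliqueSum G U 1 sizeSq          ≤⟨ *-monoʳ-≤ D (degreeSqSum-bound (suc k) U free) ⟩
    D * (A * sizeSq U)                  ≡⟨ x∙yz≈yx∙z D A (sizeSq U) ⟩
    A * D * sizeSq U                    ∎
    where
    open ≤-Reasoning
    D = cliqueConst c k j
    A = degreeSqConst c (suc k)

  orderedEdges-bound : ∀ k U → orderedCliques G U k ≡ 0 →
    orderedCliques G U 2 * orderedCliques G U 2 ≤ degreeSqConst c k * size U ^ 3
  orderedEdges-bound k U free = begin
    T₂ * T₂                                      ≡⟨ cong (λ t → t * t) (cliqueSum-size G 1 U) ⟨
    cliqueSum G U 1 size * cliqueSum G U 1 size  ≤⟨ cliqueSum-CauchySchwarz G 1 U size ⟩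
    size U * cliqueSum G U 1 sizeSq              ≤⟨ *-monoʳ-≤ (size U) (degreeSqSum-bound k U free) ⟩
    size U * (degreeSqConst c k * sizeSq U)      ≡⟨ regroup (size U) (degreeSqConst c k) ⟩
    degreeSqConst c k * size U ^ 3               ∎
    where
    open ≤-Reasoning
    T₂ = orderedCliques G U 2
    regroup : ∀ m A → m * (A * (m * m)) ≡ A * (m * (m * (m * 1)))
    regroup = solve-∀

  orderedCliques-suc-bound : ∀ k j U → orderedCliques G U k ≡ 0 →
    orderedCliques G U (suc j) * orderedCliques G U (suc j) ≤
    orderedCliques G U j * ((cliqueConst c k j + cliqueConst c k (suc j) + c ^ j) * sizeSq U)
  orderedCliques-suc-bound k j U free = begin
    T (suc j) * T (suc j)                          ≡⟨ cong (λ t → t * t) (cliqueSum-size G j U) ⟨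
    cliqueSum G U j size * cliqueSum G U j size    ≤⟨ cliqueSum-CauchySchwarz G j U size ⟩
    T j * cliqueSum G U j sizeSq                   ≤⟨ *-monoʳ-≤ (T j) (cliqueSum-sizeSq-bound j U) ⟩
    T j * (T (suc j) + T (suc (suc j)) + m * (m * c ^ j))
      ≤⟨ *-monoʳ-≤ (T j) (+-monoˡ-≤ _ (+-mono-≤ (orderedCliques-bound k j U free)
                                                 (orderedCliques-bound k (suc j) U free))) ⟩
    T j * (D j * (m * m) + D (suc j) * (m * m) + m * (m * c ^ j))
      ≡⟨ cong (T j *_) (collect (D j) (D (suc j)) (c ^ j) m) ⟩
    T j * ((D j + D (suc j) + c ^ j) * (m * m))    ∎
    where
    open ≤-Reasoning
    m = size U
    T = orderedCliques G U
    D = cliqueConst c k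
    collect : ∀ a b e m → a * (m * m) + b * (m * m) + m * (m * e) ≡ (a + b + e) * (m * m)
    collect = solve-∀

-- Cliques as subsets

tailGraph : ∀ {n} → Graph (suc n) → Graph n
tailGraph G = record
  { adj    = λ x y → adj G (suc x) (suc y)
  ; symm   = λ x y → symm G (suc x) (suc y)
  ; irrefl = λ x → irrefl G (suc x)
  }

infix 7 _⊆ᵇ_
_⊆ᵇ_ : ∀ {n} → Subset n → VSet n → Bool
[]      ⊆ᵇ U = true
(b ∷ s) ⊆ᵇ U = (not b ∨ U zero) ∧ (s ⊆ᵇ U ∘ suc)

⊆ᵇ⇔ : ∀ {n} (s : Subset n) U → s ⊆ᵇ U ≡ true ⇔ (∀ y → lookup s y ≡ true → U y ≡ true)
⊆ᵇ⇔ s U = mk⇔ (to s U) (from s U)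
  where
  to : ∀ {n} (s : Subset n) U → s ⊆ᵇ U ≡ true → ∀ y → lookup s y ≡ true → U y ≡ true
  to (true ∷ s) U s⊆U zero    _  = proj₁ (∧-true⁻ s⊆U)
  to (b    ∷ s) U s⊆U (suc y) sy = to s (U ∘ suc) (proj₂ (∧-true⁻ {not b ∨ U zero} s⊆U)) y sy
  from : ∀ {n} (s : Subset n) U → (∀ y → lookup s y ≡ true → U y ≡ true) → s ⊆ᵇ U ≡ true
  from []          U _   = refl
  from (true  ∷ s) U s⊆U = ∧-true⁺ (s⊆U zero refl) (from s (U ∘ suc) (s⊆U ∘ suc))
  from (false ∷ s) U s⊆U = from s (U ∘ suc) (s⊆U ∘ suc)

⊆ᵇ-cong : ∀ {n} (s : Subset n) {U V} → (∀ y → U y ≡ V y) → s ⊆ᵇ U ≡ s ⊆ᵇ V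
⊆ᵇ-cong []      _   = refl
⊆ᵇ-cong (b ∷ s) U≗V = cong₂ (λ p q → (not b ∨ p) ∧ q) (U≗V zero) (⊆ᵇ-cong s (U≗V ∘ suc))

⊆ᵇ-full : ∀ {n} (s : Subset n) → s ⊆ᵇ full ≡ true
⊆ᵇ-full s = Equivalence.from (⊆ᵇ⇔ s full) (λ _ _ → refl)

⊆ᵇ-∩ : ∀ {n} (s : Subset n) U V → s ⊆ᵇ U ∩ V ≡ (s ⊆ᵇ U) ∧ (s ⊆ᵇ V)
⊆ᵇ-∩ []          U V = refl
⊆ᵇ-∩ (false ∷ s) U V = ⊆ᵇ-∩ s (U ∘ suc) (V ∘ suc)
⊆ᵇ-∩ (true  ∷ s) U V rewrite ⊆ᵇ-∩ s (U ∘ suc) (V ∘ suc) =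
  solve 4 (λ u v p q → (u ⊕ v) ⊕ (p ⊕ q) ⊜ (u ⊕ p) ⊕ (v ⊕ q)) refl
    (U zero) (V zero) (s ⊆ᵇ U ∘ suc) (s ⊆ᵇ V ∘ suc)

IsClique : ∀ {n} → Graph n → Subset n → Set
IsClique {n} G s = ∀ (x y : Fin n) → lookup s x ≡ true → lookup s y ≡ true → x ≢ y → adj G x y ≡ true

isCliqueB⇔IsClique : ∀ {n} (G : Graph n) s → isCliqueB G s ≡ true ⇔ IsClique G s
isCliqueB⇔IsClique {n} G s = mk⇔
  (λ isC x y → Equivalence.to (pair⇔ x y) (rows⇒ isC x y))
  (λ isC → subst (_≡ true) (sym (and-concatMap row (allFin n)))
     (Equivalence.from (and-map-tabulate⇔ (and ∘ row) id) (λ x →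
       Equivalence.from (and-map-tabulate⇔ (pair x) id) (λ y →
         Equivalence.from (pair⇔ x y) (isC x y)))))
  where
  pair : Fin n → Fin n → Bool
  pair x y = not (lookup s x ∧ lookup s y ∧ not ⌊ x Fin.≟ y ⌋) ∨ adj G x y
  row : Fin n → List Bool
  row x = map (pair x) (allFin n)
  rows⇒ : isCliqueB G s ≡ true → ∀ x y → pair x y ≡ true
  rows⇒ isC x = Equivalence.to (and-map-tabulate⇔ (pair x) id)
    (Equivalence.to (and-map-tabulate⇔ (and ∘ row) id) (trans (sym (and-concatMap row (allFin n))) isC) x)
  pair⇔ : ∀ x y →
    pair x y ≡ true ⇔ (lookup s x ≡ true → lookup s y ≡ true → x ≢ y → adj G x y ≡ true)
  pair⇔ x y with lookup s x | lookup s y | x Fin.≟ y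
  ... | true  | true  | yes x≡y = mk⇔ (λ _ _ _ x≢y → contradiction x≡y x≢y) (λ _ → refl)
  ... | true  | true  | no  x≢y = mk⇔ (λ xy _ _ _ → xy) (λ h → h refl refl x≢y)
  ... | true  | false | _       = mk⇔ (λ _ _ ()) (λ _ → refl)
  ... | false | _     | _       = mk⇔ (λ _ ()) (λ _ → refl)

IsClique-∷ : ∀ {n} (G : Graph (suc n)) b s →
  IsClique G (b ∷ s) ⇔ ((b ≡ true → s ⊆ᵇ N G zero ∘ suc ≡ true) × IsClique (tailGraph G) s)
IsClique-∷ G b s = mk⇔
  (λ isC → (λ b≡true → Equivalence.from (⊆ᵇ⇔ s _) (λ y sy → isC zero (suc y) b≡true sy (λ ())))
         , (λ x y sx sy x≢y → isC (suc x) (suc y) sx sy (x≢y ∘ Fin.suc-injective)))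
  (λ (zero⇒ , isC) → from zero⇒ isC)
  where
  from : (b ≡ true → s ⊆ᵇ N G zero ∘ suc ≡ true) → IsClique (tailGraph G) s → IsClique G (b ∷ s)
  from zero⇒ isC zero    zero    _  _  x≢y = contradiction refl x≢y
  from zero⇒ isC zero    (suc y) b  sy _   = Equivalence.to (⊆ᵇ⇔ s _) (zero⇒ b) y sy
  from zero⇒ isC (suc x) zero    sx b  _   =
    trans (symm G (suc x) zero) (Equivalence.to (⊆ᵇ⇔ s _) (zero⇒ b) x sx)
  from zero⇒ isC (suc x) (suc y) sx sy x≢y = isC x y sx sy (x≢y ∘ cong suc)

isCliqueB-∷ : ∀ {n} (G : Graph (suc n)) b s →
  isCliqueB G (b ∷ s) ≡ (not b ∨ (s ⊆ᵇ N G zero ∘ suc)) ∧ isCliqueB (tailGraph G) s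
isCliqueB-∷ G b s = ⇔→≡ (⇔.trans (isCliqueB⇔IsClique G (b ∷ s)) (⇔.trans (IsClique-∷ G b s)
  (⇔.trans (⇔.sym not∨≡true⇔ ×-⇔ ⇔.sym (isCliqueB⇔IsClique (tailGraph G) s)) (⇔.sym ∧≡true⇔))))

cliqueInᵇ : ∀ {n} → Graph n → VSet n → ℕ → Subset n → Bool
cliqueInᵇ G U j s = eqℕ ∣ s ∣ j ∧ (isCliqueB G s ∧ s ⊆ᵇ U)

cliquesIn : ∀ {n} → Graph n → VSet n → ℕ → ℕ
cliquesIn {n} G U j = countTrue (map (cliqueInᵇ G U j) (allSubsets n))

cliquesIn-cong : ∀ {n} (G : Graph n) j {U V} → (∀ y → U y ≡ V y) → cliquesIn G U j ≡ cliquesIn G V j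
cliquesIn-cong {n} G j U≗V =
  countTrue-cong (λ s → cong (λ b → eqℕ ∣ s ∣ j ∧ (isCliqueB G s ∧ b)) (⊆ᵇ-cong s U≗V)) (allSubsets n)

module _ {n : ℕ} (G : Graph (suc n)) (U : VSet (suc n)) where

  private
    G′ = tailGraph G

  cliquesIn-outside : ∀ j →
    countTrue (map (cliqueInᵇ G U j ∘ (outside ∷_)) (allSubsets n)) ≡ cliquesIn G′ (U ∘ suc) j
  cliquesIn-outside j = countTrue-cong (λ s →
    cong (λ b → eqℕ ∣ s ∣ j ∧ (b ∧ s ⊆ᵇ U ∘ suc)) (isCliqueB-∷ G outside s)) (allSubsets n)

  cliquesIn-inside : ∀ j → countTrue (map (cliqueInᵇ G U (suc j) ∘ (inside ∷_)) (allSubsets n))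
                           ≡ 𝟙 (U zero) * cliquesIn G′ ((U ∩ N G zero) ∘ suc) j
  cliquesIn-inside j = trans (countTrue-cong regroup (allSubsets n)) (countTrue-∧ˡ (U zero) _ (allSubsets n))
    where
    regroup : ∀ s →
      cliqueInᵇ G U (suc j) (inside ∷ s) ≡ U zero ∧ cliqueInᵇ G′ ((U ∩ N G zero) ∘ suc) j s
    regroup s rewrite isCliqueB-∷ G inside s | ⊆ᵇ-∩ s (U ∘ suc) (N G zero ∘ suc) =
      solve 5 (λ e a c u p → e ⊕ ((a ⊕ c) ⊕ (u ⊕ p)) ⊜ u ⊕ (e ⊕ (c ⊕ (p ⊕ a)))) refl
        (eqℕ ∣ s ∣ j) (s ⊆ᵇ N G zero ∘ suc) (isCliqueB G′ s) (U zero) (s ⊆ᵇ U ∘ suc)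

  cliquesIn-zero-tail : cliquesIn G U 0 ≡ cliquesIn G′ (U ∘ suc) 0
  cliquesIn-zero-tail = trans (countTrue-allSubsets-suc (cliqueInᵇ G U 0))
    (trans (cong₂ _+_ (cliquesIn-outside 0) (countTrue-map-false (allSubsets n))) (+-identityʳ _))

  cliquesIn-suc : ∀ j → cliquesIn G U (suc j) ≡
    cliquesIn G′ (U ∘ suc) (suc j) + 𝟙 (U zero) * cliquesIn G′ ((U ∩ N G zero) ∘ suc) j
  cliquesIn-suc j = trans (countTrue-allSubsets-suc (cliqueInᵇ G U (suc j)))
                          (cong₂ _+_ (cliquesIn-outside (suc j)) (cliquesIn-inside j))

cliquesIn-zero : ∀ {n} (G : Graph n) U → cliquesIn G U 0 ≡ 1
cliquesIn-zero {zero}  G U = refl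
cliquesIn-zero {suc n} G U = trans (cliquesIn-zero-tail G U) (cliquesIn-zero (tailGraph G) (U ∘ suc))

cliquesIn-one : ∀ {n} (G : Graph n) U → cliquesIn G U 1 ≡ size U
cliquesIn-one {zero}  G U = refl
cliquesIn-one {suc n} G U = begin
  cliquesIn G U 1
    ≡⟨ cliquesIn-suc G U 0 ⟩
  cliquesIn G′ (U ∘ suc) 1 + 𝟙 (U zero) * cliquesIn G′ ((U ∩ N G zero) ∘ suc) 0
    ≡⟨ cong₂ _+_ (cliquesIn-one G′ (U ∘ suc)) (cong (𝟙 (U zero) *_) (cliquesIn-zero G′ _)) ⟩
  size (U ∘ suc) + 𝟙 (U zero) * 1
    ≡⟨ +-comm (size (U ∘ suc)) (𝟙 (U zero) * 1) ⟩
  size U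
    ∎
  where
  open ≡-Reasoning
  G′ = tailGraph G

-- Each (j+1)-clique of U arises from each of its j+1 vertices x as x together with a
-- j-clique of U ∩ N x.
∑∈-cliquesIn : ∀ {n} (G : Graph n) U j →
               ∑[ x ∈ U ] cliquesIn G (U ∩ N G x) j ≡ suc j * cliquesIn G U (suc j)
∑∈-cliquesIn G U zero = trans (∑∈-cong U (λ x → cliquesIn-zero G (U ∩ N G x)))
                               (trans (sym (cliquesIn-one G U)) (sym (+-identityʳ _)))
∑∈-cliquesIn {zero}  G U (suc j) = sym (*-zeroʳ (suc (suc j)))
∑∈-cliquesIn {suc n} G U (suc j) = begin
  𝟙 (U zero) * cliquesIn G (U ∩ N G zero) (suc j) + ∑[ x ∈ U′ ] cliquesIn G (U ∩ N G (suc x)) (suc j)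
    ≡⟨ cong₂ _+_ (cong (𝟙 (U zero) *_) (trans (cliquesIn-suc G (U ∩ N G zero) j) loopless))
                 (∑∈-cong U′ (λ x → cliquesIn-suc G (U ∩ N G (suc x)) j)) ⟩
  𝟙 (U zero) * (R + 0) + ∑[ x ∈ U′ ] (cliquesIn G′ (U′ ∩ N G′ x) (suc j) + through-zero x)
    ≡⟨ cong (𝟙 (U zero) * (R + 0) +_)
            (trans (∑∈-+ U′ _ through-zero) (cong₂ _+_ (∑∈-cliquesIn G′ U′ (suc j)) move-zero)) ⟩
  𝟙 (U zero) * (R + 0) + (suc (suc j) * X + 𝟙 (U zero) * (suc j * R))
    ≡⟨ collect (𝟙 (U zero)) R X j ⟩
  suc (suc j) * (X + 𝟙 (U zero) * R)
    ≡⟨ cong (suc (suc j) *_) (cliquesIn-suc G U (suc j)) ⟨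
  suc (suc j) * cliquesIn G U (suc (suc j)) ∎
  where
  open ≡-Reasoning
  G′ = tailGraph G
  U′ = U ∘ suc
  W = (U ∩ N G zero) ∘ suc
  R = cliquesIn G′ W (suc j)
  X = cliquesIn G′ U′ (suc (suc j))
  C : Fin n → ℕ
  C x = cliquesIn G′ ((U ∩ N G (suc x) ∩ N G zero) ∘ suc) j
  through-zero : Fin n → ℕ
  through-zero x = 𝟙 (U zero ∧ adj G (suc x) zero) * C x
  C₀ = cliquesIn G′ ((U ∩ N G zero ∩ N G zero) ∘ suc) j
  loopless : R + 𝟙 (U zero ∧ adj G zero zero) * C₀ ≡ R + 0
  loopless = trans (cong (λ b → R + 𝟙 (U zero ∧ b) * C₀) (irrefl G zero))
                   (cong (λ b → R + 𝟙 b * C₀) (∧-zeroʳ (U zero)))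
  move-zero : ∑∈ U′ through-zero ≡ 𝟙 (U zero) * (suc j * R)
  move-zero = begin
    ∑∈ U′ through-zero
      ≡⟨ ∑∈-cong U′ (λ x → cong (λ b → 𝟙 (U zero ∧ b) * C x) (symm G (suc x) zero)) ⟩
    ∑[ x ∈ U′ ] (𝟙 (U zero ∧ adj G zero (suc x)) * C x)
      ≡⟨ sum-cong-≗ (λ x → 𝟙-∧-exchange (U (suc x)) (U zero) (adj G zero (suc x)) (C x)) ⟩
    ∑[ x ∈ W ] (𝟙 (U zero) * C x)
      ≡⟨ ∑∈-cong W (λ x → cong (𝟙 (U zero) *_) (cliquesIn-cong G′ j (λ y →
           ∧-swapʳ (U (suc y)) (adj G (suc x) (suc y)) (adj G zero (suc y))))) ⟩
    ∑[ x ∈ W ] (𝟙 (U zero) * cliquesIn G′ (W ∩ N G′ x) j)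
      ≡⟨ *-distribˡ-∑∈ (𝟙 (U zero)) W _ ⟨
    𝟙 (U zero) * ∑[ x ∈ W ] cliquesIn G′ (W ∩ N G′ x) j
      ≡⟨ cong (𝟙 (U zero) *_) (∑∈-cliquesIn G′ W j) ⟩
    𝟙 (U zero) * (suc j * R) ∎
    where
    ∧-swapʳ : ∀ p q r → (p ∧ q) ∧ r ≡ (p ∧ r) ∧ q
    ∧-swapʳ = solve 3 (λ p q r → (p ⊕ q) ⊕ r ⊜ (p ⊕ r) ⊕ q) refl
  collect : ∀ b R X j → b * (R + 0) + (suc (suc j) * X + b * (suc j * R)) ≡ suc (suc j) * (X + b * R)
  collect = solve-∀

orderedCliques≡!*cliquesIn : ∀ {n} (G : Graph n) j U → orderedCliques G U j ≡ j ! * cliquesIn G U j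
orderedCliques≡!*cliquesIn G zero    U = sym (trans (+-identityʳ _) (cliquesIn-zero G U))
orderedCliques≡!*cliquesIn G (suc j) U = begin
  ∑[ x ∈ U ] orderedCliques G (U ∩ N G x) j         ≡⟨ ∑∈-cong U (λ x → orderedCliques≡!*cliquesIn G j _) ⟩
  ∑[ x ∈ U ] (j ! * cliquesIn G (U ∩ N G x) j)      ≡⟨ *-distribˡ-∑∈ (j !) U _ ⟨
  j ! * ∑[ x ∈ U ] cliquesIn G (U ∩ N G x) j        ≡⟨ cong (j ! *_) (∑∈-cliquesIn G U j) ⟩
  j ! * (suc j * cliquesIn G U (suc j))             ≡⟨ x∙yz≈yx∙z (j !) (suc j) _ ⟩
  suc j * j ! * cliquesIn G U (suc j)               ∎
  where open ≡-Reasoning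

orderedCliques-full : ∀ {n} (G : Graph n) j → orderedCliques G full j ≡ j ! * cliqueCount G j
orderedCliques-full {n} G j =
  trans (orderedCliques≡!*cliquesIn G j full) (cong (j ! *_) (sym cliqueCount≡cliquesIn))
  where
  cliqueCount≡cliquesIn : cliqueCount G j ≡ cliquesIn G full j
  cliqueCount≡cliquesIn = countTrue-cong (λ s → cong (eqℕ ∣ s ∣ j ∧_)
    (sym (trans (cong (isCliqueB G s ∧_) (⊆ᵇ-full s)) (∧-identityʳ _)))) (allSubsets n)

KFree⇒orderedCliques≡0 : ∀ {n} {G : Graph n} k → KFree k G → orderedCliques G full k ≡ 0
KFree⇒orderedCliques≡0 {G = G} k free =
  trans (orderedCliques-full G k) (trans (cong (k ! *_) free) (*-zeroʳ (k !)))

cliqueCount≤orderedCliques : ∀ {n} (G : Graph n) j → cliqueCount G j ≤ orderedCliques G full j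
cliqueCount≤orderedCliques G j =
  ≤-trans (m≤n*m _ (j !) {{j !≢0}}) (≤-reflexive (sym (orderedCliques-full G j)))

numEdges≤orderedEdges : ∀ {n} (G : Graph n) → numEdges G ≤ orderedCliques G full 2
numEdges≤orderedEdges {n} G = begin
  numEdges G
    ≡⟨ countTrue-concatMap-tabulate (λ x → map (edge x) (allFin n)) id ⟩
  sum (λ x → countTrue (map (edge x) (allFin n)))
    ≡⟨ sum-cong-≗ (λ x → countTrue-map-tabulate (edge x) id) ⟩
  sum (λ x → sum (λ y → 𝟙 (edge x y)))
    ≤⟨ ∑-mono-≤ (λ x → ≤-trans (∑-mono-≤ (λ y → forget-order ⌊ toℕ x <? toℕ y ⌋ (adj G x y)))
                                (≤-reflexive (sym (*-identityˡ _)))) ⟩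
  orderedCliques G full 2
    ∎
  where
  open ≤-Reasoning
  edge : Fin n → Fin n → Bool
  edge x y = ⌊ toℕ x <? toℕ y ⌋ ∧ adj G x y
  forget-order : ∀ b e → 𝟙 (b ∧ e) ≤ 𝟙 (true ∧ e) * 1
  forget-order true  e = ≤-reflexive (sym (*-identityʳ _))
  forget-order false e = z≤n

module _ (c k : ℕ) {n} (G : Graph n) (closed : CClosed c G) (free : KFree k G) where

  numEdges²-bound : numEdges G ^ 2 ≤ degreeSqConst c k * n ^ 3
  numEdges²-bound = begin
    numEdges G * (numEdges G * 1)                      ≡⟨ cong (numEdges G *_) (*-identityʳ _) ⟩
    numEdges G * numEdges G                            ≤⟨ *-mono-≤ e≤T₂ e≤T₂ ⟩
    orderedCliques G full 2 * orderedCliques G full 2  ≤⟨ orderedEdges-bound closed k full full-free ⟩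
    degreeSqConst c k * size (full {n}) ^ 3            ≡⟨ cong (λ m → degreeSqConst c k * m ^ 3) (size-full n) ⟩
    degreeSqConst c k * n ^ 3                          ∎
    where
    open ≤-Reasoning
    full-free = KFree⇒orderedCliques≡0 {G = G} k free
    e≤T₂ = numEdges≤orderedEdges G

  cliqueCount²-bound : ∀ j → cliqueCount G (suc j) ^ 2 ≤
    (cliqueConst c k j + cliqueConst c k (suc j) + c ^ j) * j ! * cliqueCount G j * n ^ 2
  cliqueCount²-bound j = begin
    n₊ * (n₊ * 1)                        ≡⟨ cong (n₊ *_) (*-identityʳ n₊) ⟩
    n₊ * n₊                              ≤⟨ *-mono-≤ n₊≤T₊ n₊≤T₊ ⟩
    T (suc j) * T (suc j)                ≤⟨ orderedCliques-suc-bound closed k j full full-free ⟩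
    T j * (K * sizeSq (full {n}))        ≡⟨ cong₂ (λ t m → t * (K * (m * m))) (orderedCliques-full G j) (size-full n) ⟩
    j ! * cliqueCount G j * (K * (n * n)) ≡⟨ regroup (j !) (cliqueCount G j) K n ⟩
    K * j ! * cliqueCount G j * n ^ 2    ∎
    where
    open ≤-Reasoning
    n₊ = cliqueCount G (suc j)
    n₊≤T₊ = cliqueCount≤orderedCliques G (suc j)
    T = orderedCliques G full
    K = cliqueConst c k j + cliqueConst c k (suc j) + c ^ j
    full-free = KFree⇒orderedCliques≡0 {G = G} k free
    regroup : ∀ f m K n → f * m * (K * (n * n)) ≡ K * f * m * (n * (n * 1))
    regroup = solve-∀

theoremD1 : ∀ (c k : ℕ) → 1 ≤ c → 2 ≤ k →
    (Σ ℕ λ C → ∀ (n : ℕ) (G : Graph n) → CClosed c G → KFree k G →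
        numEdges G ^ 2 ≤ C * n ^ 3)
    × (∀ (j : ℕ) → 2 < j → Σ ℕ λ C → ∀ (n : ℕ) (G : Graph n) → CClosed c G → KFree k G →
        cliqueCount G (suc j) ^ 2 ≤ C * cliqueCount G j * n ^ 2)
theoremD1 c k _ _ =
    (degreeSqConst c k , λ n G closed free → numEdges²-bound c k G closed free)
  , λ j _ → ( (cliqueConst c k j + cliqueConst c k (suc j) + c ^ j) * j !
            , λ n G closed free → cliqueCount²-bound c k G closed free j)
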